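{- Let $n$, $a$, $q$, $r$ be integers such that either $n=qa$ with $a\ge 4$ and $q\ge 3$, or $n=qa+r$ with $q\ge 2$, $1\le r\le a-1$ and $4\le a\le r+q+1$. Then for every two vertices $v_i,v_j$ of $\overrightarrow{C}(n;1,a)$ with $0\le i<j\le n-1$, $$d(v_i,v_j) = \left\lfloor\frac{j-i}{a}\right\rfloor(1-a) + j - i.$$
   Context: The oriented circulant graph $\overrightarrow{C}(n;1,a)$ has vertex set $\{v_0,\dots,v_{n-1}\}$ and arcs $v_kv_{k+1}$ and $v_kv_{k+a}$ for all $k$, subscripts modulo $n$. $d(u,v)$ is the length of a shortest directed path from $u$ to $v$. -}

module Defs where

open import Data.Nat using (ℕ; zero; suc; _+_; _≤_; NonZero)
open import Data.Nat.DivMod using (_%_)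
open import Data.Fin using (Fin; toℕ)
open import Data.Sum using (_⊎_)
open import Data.Product using (Σ; _×_)
open import Relation.Binary.PropositionalEquality using (_≡_)

-- The oriented circulant graph C→(n;1,a) on vertex set Fin n
-- (vertex v_k is represented by k : Fin n).
-- There is an arc from v_x to v_y iff y ≡ x + 1 (mod n) or y ≡ x + a (mod n).
Arc : (n a : ℕ) → .{{_ : NonZero n}} → Fin n → Fin n → Set
Arc n a x y = (toℕ y ≡ (toℕ x + 1) % n) ⊎ (toℕ y ≡ (toℕ x + a) % n)

data Walk (n a : ℕ) .{{_ : NonZero n}} : Fin n → Fin n → ℕ → Set where
  here  : ∀ {u} → Walk n a u u zero
  step  : ∀ {u v w k} → Arc n a u v → Walk n a v w k → Walk n a u w (suc k)

-- d(u,v) = d : d is the length of a shortest directed path from u to v,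
-- i.e. some directed walk of length d exists and every directed walk from
-- u to v has length ≥ d (a shortest walk is always a path).
IsDistance : (n a : ℕ) → .{{_ : NonZero n}} → Fin n → Fin n → ℕ → Set
IsDistance n a u v d =
  Walk n a u v d × (∀ k → Walk n a u v k → d ≤ k)

{-# OPTIONS --safe #-}
-- A walk with s arcs of length a and t arcs of length 1 leads from v_i to v_j
-- exactly when s a + t = m + c n for some c, where m = j - i.  For a fixed
-- total V = s a + t the number of arcs s + t is least when s = ⌊V/a⌋, namely
-- minSteps a V = ⌊V/a⌋ + V mod a = V - ⌊V/a⌋(a - 1).  Under the hypotheses,
-- adding n = q a + r to V never decreases minSteps: it adds q to the
-- quotient and r to the remainder, and a carry costs at most a - 1 ≤ q + r.
-- Hence the minimum over c is attained at c = 0, by the walk of ⌊m/a⌋ long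
-- arcs followed by m mod a short ones, which never wraps around.
module Submission where

open import Defs
open import Data.Nat using (ℕ; zero; suc; _+_; _*_; _∸_; _≤_; _<_; NonZero; >-nonZero⁻¹; s≤s⁻¹)
open import Data.Nat.Properties
open import Data.Nat.DivMod
open import Data.Nat.Divisibility using (n∣m*n)
open import Data.Fin using (Fin; toℕ; fromℕ<)
open import Data.Fin.Properties using (toℕ<n; toℕ-injective; toℕ-fromℕ<)
open import Data.Sum using (_⊎_; inj₁; inj₂)
open import Data.Product using (Σ-syntax; ∃-syntax; _×_; _,_)
open import Relation.Binary.PropositionalEquality
open import Algebra.Properties.CommutativeSemigroup +-commutativeSemigroup
  using (xy∙z≈xz∙y; xy∙z≈y∙xz; xy∙z≈x∙zy; x∙yz≈yx∙z)

minSteps : (a : ℕ) .{{_ : NonZero a}} → ℕ → ℕ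
minSteps a m = m / a + m % a

NoShortcut : (a : ℕ) .{{_ : NonZero a}} → ℕ → Set
NoShortcut a n = ∀ m → minSteps a m ≤ minSteps a (m + n)

module _ (a : ℕ) .{{_ : NonZero a}} where

  minSteps-+-* : ∀ m k → minSteps a (m + k * a) ≡ minSteps a m + k
  minSteps-+-* m k = begin
    (m + k * a) / a + (m + k * a) % a ≡⟨ cong₂ _+_ (+-distrib-/-∣ʳ m (n∣m*n k)) ([m+kn]%n≡m%n m k a) ⟩
    m / a + k * a / a + m % a         ≡⟨ cong (λ x → m / a + x + m % a) (m*n/n≡m k a) ⟩
    m / a + k + m % a                 ≡⟨ xy∙z≈xz∙y (m / a) k (m % a) ⟩
    minSteps a m + k                  ∎
    where open ≡-Reasoning

  minSteps+[m/a]*[a∸1]≡m : ∀ m → minSteps a m + (m / a) * (a ∸ 1) ≡ m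
  minSteps+[m/a]*[a∸1]≡m m = begin
    m / a + m % a + (m / a) * (a ∸ 1)   ≡⟨ xy∙z≈y∙xz (m / a) (m % a) _ ⟩
    m % a + (m / a + (m / a) * (a ∸ 1)) ≡⟨ cong (m % a +_) (*-suc (m / a) (a ∸ 1)) ⟨
    m % a + (m / a) * suc (a ∸ 1)       ≡⟨ cong (λ b → m % a + (m / a) * b) (m+[n∸m]≡n (>-nonZero⁻¹ a)) ⟩
    m % a + (m / a) * a                 ≡⟨ m≡m%n+[m/n]*n m a ⟨
    m                                   ∎
    where open ≡-Reasoning

  m∸[m/a]*[a∸1]≡minSteps : ∀ m → m ∸ (m / a) * (a ∸ 1) ≡ minSteps a m
  m∸[m/a]*[a∸1]≡minSteps m =
    trans (cong (_∸ (m / a) * (a ∸ 1)) (sym (minSteps+[m/a]*[a∸1]≡m m))) (m+n∸n≡m (minSteps a m) ((m / a) * (a ∸ 1)))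

  minSteps≤m : ∀ m → minSteps a m ≤ m
  minSteps≤m m = subst (minSteps a m ≤_) (minSteps+[m/a]*[a∸1]≡m m) (m≤m+n _ _)

  minSteps-minimal : ∀ s t → minSteps a (s * a + t) ≤ s + t
  minSteps-minimal s t = begin
    minSteps a (s * a + t) ≡⟨ cong (minSteps a) (+-comm (s * a) t) ⟩
    minSteps a (t + s * a) ≡⟨ minSteps-+-* t s ⟩
    minSteps a t + s       ≤⟨ +-monoˡ-≤ s (minSteps≤m t) ⟩
    t + s                  ≡⟨ +-comm t s ⟩
    s + t                  ∎
    where open ≤-Reasoning

  m<2a⇒m≤minSteps+[a∸1] : ∀ m → m < 2 * a → m ≤ minSteps a m + (a ∸ 1)
  m<2a⇒m≤minSteps+[a∸1] m m<2a = begin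
    m                                 ≡⟨ minSteps+[m/a]*[a∸1]≡m m ⟨
    minSteps a m + (m / a) * (a ∸ 1)  ≤⟨ +-monoʳ-≤ (minSteps a m) (*-monoˡ-≤ (a ∸ 1) m/a≤1) ⟩
    minSteps a m + 1 * (a ∸ 1)        ≡⟨ cong (minSteps a m +_) (*-identityˡ (a ∸ 1)) ⟩
    minSteps a m + (a ∸ 1)            ∎
    where
    open ≤-Reasoning
    m/a≤1 : m / a ≤ 1
    m/a≤1 = s≤s⁻¹ (m<n*o⇒m/o<n m<2a)

  minSteps-+-≤ : ∀ m r → r ≤ a → minSteps a m + r ≤ minSteps a (m + r) + (a ∸ 1)
  minSteps-+-≤ m r r≤a = begin
    m / a + m % a + r                           ≡⟨ +-assoc (m / a) (m % a) r ⟩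
    m / a + (m % a + r)                         ≤⟨ +-monoʳ-≤ (m / a) (m<2a⇒m≤minSteps+[a∸1] (m % a + r) rem+r<2a) ⟩
    m / a + (minSteps a (m % a + r) + (a ∸ 1))  ≡⟨ x∙yz≈yx∙z (m / a) _ (a ∸ 1) ⟩
    minSteps a (m % a + r) + m / a + (a ∸ 1)    ≡⟨ cong (_+ (a ∸ 1)) (minSteps-+-* (m % a + r) (m / a)) ⟨
    minSteps a (m % a + r + m / a * a) + (a ∸ 1) ≡⟨ cong (λ x → minSteps a x + (a ∸ 1)) m+r≡ ⟨
    minSteps a (m + r) + (a ∸ 1)                ∎
    where
    open ≤-Reasoning
    rem+r<2a : m % a + r < 2 * a
    rem+r<2a = subst (m % a + r <_) (cong (a +_) (sym (+-identityʳ a))) (+-mono-<-≤ (m%n<n m a) r≤a)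
    m+r≡ : m + r ≡ m % a + r + m / a * a
    m+r≡ = trans (cong (_+ r) (m≡m%n+[m/n]*n m a)) (xy∙z≈xz∙y (m % a) _ r)

  minSteps-≤-+-* : ∀ q → NoShortcut a (q * a)
  minSteps-≤-+-* q m = subst (minSteps a m ≤_) (sym (minSteps-+-* m q)) (m≤m+n _ q)

  minSteps-≤-+-*-+ : ∀ q r → r ≤ a → a ∸ 1 ≤ r + q → NoShortcut a (q * a + r)
  minSteps-≤-+-*-+ q r r≤a a∸1≤r+q m = +-cancelʳ-≤ (r + q) _ _ (begin
    minSteps a m + (r + q)                  ≡⟨ +-assoc (minSteps a m) r q ⟨
    minSteps a m + r + q                    ≤⟨ +-monoˡ-≤ q (minSteps-+-≤ m r r≤a) ⟩
    minSteps a (m + r) + (a ∸ 1) + q        ≡⟨ xy∙z≈xz∙y _ (a ∸ 1) q ⟩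
    minSteps a (m + r) + q + (a ∸ 1)        ≡⟨ cong (_+ (a ∸ 1)) (minSteps-+-* (m + r) q) ⟨
    minSteps a (m + r + q * a) + (a ∸ 1)    ≡⟨ cong (λ x → minSteps a x + (a ∸ 1)) (xy∙z≈x∙zy m r (q * a)) ⟩
    minSteps a (m + (q * a + r)) + (a ∸ 1)  ≤⟨ +-monoʳ-≤ _ a∸1≤r+q ⟩
    minSteps a (m + (q * a + r)) + (r + q)  ∎)
    where open ≤-Reasoning

≤-shift⇒≤-shift-* : (f : ℕ → ℕ) (n : ℕ) → (∀ m → f m ≤ f (m + n)) → ∀ c m → f m ≤ f (m + c * n)
≤-shift⇒≤-shift-* f n shift zero    m = ≤-reflexive (cong f (sym (+-identityʳ m)))
≤-shift⇒≤-shift-* f n shift (suc c) m = begin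
  f m                 ≤⟨ ≤-shift⇒≤-shift-* f n shift c m ⟩
  f (m + c * n)       ≤⟨ shift (m + c * n) ⟩
  f (m + c * n + n)   ≡⟨ cong f (xy∙z≈x∙zy m (c * n) n) ⟩
  f (m + suc c * n)   ∎
  where open ≤-Reasoning

[m%n+k]%n≡[m+k]%n : ∀ m k n .{{_ : NonZero n}} → (m % n + k) % n ≡ (m + k) % n
[m%n+k]%n≡[m+k]%n m k n = begin
  (m % n + k) % n         ≡⟨ %-distribˡ-+ (m % n) k n ⟩
  (m % n % n + k % n) % n ≡⟨ cong (λ x → (x + k % n) % n) (m%n%n≡m%n m n) ⟩
  (m % n + k % n) % n     ≡⟨ %-distribˡ-+ m k n ⟨
  (m + k) % n             ∎
  where open ≡-Reasoning

[x+v]%n≡y⇒v≡y∸x+[x+v]/n*n : ∀ {x v y} n .{{_ : NonZero n}} → x ≤ y → (x + v) % n ≡ y →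
                             v ≡ (y ∸ x) + ((x + v) / n) * n
[x+v]%n≡y⇒v≡y∸x+[x+v]/n*n {x} {v} {y} n x≤y eq = +-cancelˡ-≡ x _ _ (begin
  x + v                  ≡⟨ m≡m%n+[m/n]*n (x + v) n ⟩
  (x + v) % n + c * n    ≡⟨ cong (_+ c * n) eq ⟩
  y + c * n              ≡⟨ cong (_+ c * n) (m+[n∸m]≡n x≤y) ⟨
  x + (y ∸ x) + c * n    ≡⟨ +-assoc x (y ∸ x) (c * n) ⟩
  x + ((y ∸ x) + c * n)  ∎)
  where
  open ≡-Reasoning
  c = (x + v) / n

module _ (n a : ℕ) .{{_ : NonZero n}} where

  displacement-trans : ∀ {x y w : Fin n} d e → toℕ y ≡ (toℕ x + d) % n → (toℕ y + e) % n ≡ toℕ w →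
                       (toℕ x + (d + e)) % n ≡ toℕ w
  displacement-trans {x} {y} {w} d e xy yw = begin
    (toℕ x + (d + e)) % n     ≡⟨ cong (_% n) (+-assoc (toℕ x) d e) ⟨
    (toℕ x + d + e) % n       ≡⟨ [m%n+k]%n≡[m+k]%n (toℕ x + d) e n ⟨
    ((toℕ x + d) % n + e) % n ≡⟨ cong (λ z → (z + e) % n) xy ⟨
    (toℕ y + e) % n           ≡⟨ yw ⟩
    toℕ w                     ∎
    where open ≡-Reasoning

  walk-displacement : ∀ {x w k} → Walk n a x w k →
    ∃[ s ] ∃[ t ] s + t ≡ k × (toℕ x + (s * a + t)) % n ≡ toℕ w
  walk-displacement {x} here =
    0 , 0 , refl , trans (cong (_% n) (+-identityʳ (toℕ x))) (m<n⇒m%n≡m (toℕ<n x))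
  walk-displacement {x} {w} (step (inj₁ xy) rest) with walk-displacement rest
  ... | s , t , s+t≡k , yw =
    s , suc t , trans (+-suc s t) (cong suc s+t≡k) ,
    subst (λ v → (toℕ x + v) % n ≡ toℕ w) (sym (+-suc (s * a) t)) (displacement-trans 1 (s * a + t) xy yw)
  walk-displacement {x} {w} (step (inj₂ xy) rest) with walk-displacement rest
  ... | s , t , s+t≡k , yw =
    suc s , t , cong suc s+t≡k ,
    subst (λ v → (toℕ x + v) % n ≡ toℕ w) (sym (+-assoc a (s * a) t)) (displacement-trans a (s * a + t) xy yw)

  split-forward : (x y : Fin n) → ∀ d e → toℕ x + (d + e) ≡ toℕ y →
    Σ[ z ∈ Fin n ] toℕ z ≡ (toℕ x + d) % n × toℕ z + e ≡ toℕ y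
  split-forward x y d e eq = fromℕ< x+d<n , xz , zy
    where
    x+d+e≡y : toℕ x + d + e ≡ toℕ y
    x+d+e≡y = trans (+-assoc (toℕ x) d e) eq
    x+d<n : toℕ x + d < n
    x+d<n = ≤-<-trans (subst (toℕ x + d ≤_) x+d+e≡y (m≤m+n _ e)) (toℕ<n y)
    xz : toℕ (fromℕ< x+d<n) ≡ (toℕ x + d) % n
    xz = trans (toℕ-fromℕ< x+d<n) (sym (m<n⇒m%n≡m x+d<n))
    zy : toℕ (fromℕ< x+d<n) + e ≡ toℕ y
    zy = trans (cong (_+ e) (toℕ-fromℕ< x+d<n)) x+d+e≡y

  forward-walk : ∀ s t (x y : Fin n) → toℕ x + (s * a + t) ≡ toℕ y → Walk n a x y (s + t)
  forward-walk zero zero x y eq =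
    subst (λ z → Walk n a x z 0) (toℕ-injective (trans (sym (+-identityʳ (toℕ x))) eq)) here
  forward-walk zero (suc t) x y eq with split-forward x y 1 t eq
  ... | z , xz , zy = step (inj₁ xz) (forward-walk zero t z y zy)
  forward-walk (suc s) t x y eq
    with split-forward x y a (s * a + t) (trans (cong (toℕ x +_) (sym (+-assoc a (s * a) t))) eq)
  ... | z , xz , zy = step (inj₂ xz) (forward-walk s t z y zy)

  circulant-distance : .{{_ : NonZero a}} → NoShortcut a n → (i j : Fin n) → toℕ i ≤ toℕ j →
    IsDistance n a i j ((toℕ j ∸ toℕ i) ∸ ((toℕ j ∸ toℕ i) / a) * (a ∸ 1))
  circulant-distance noShortcut i j i≤j =
    subst (IsDistance n a i j) (sym (m∸[m/a]*[a∸1]≡minSteps a m))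
      (forward-walk (m / a) (m % a) i j i+m≡j , shortest)
    where
    m = toℕ j ∸ toℕ i
    i+m≡j : toℕ i + (m / a * a + m % a) ≡ toℕ j
    i+m≡j = trans (cong (toℕ i +_) (trans (+-comm _ (m % a)) (sym (m≡m%n+[m/n]*n m a)))) (m+[n∸m]≡n i≤j)
    shortest : ∀ k → Walk n a i j k → minSteps a m ≤ k
    shortest k w with walk-displacement w
    ... | s , t , refl , ij = begin
      minSteps a m                ≤⟨ ≤-shift⇒≤-shift-* (minSteps a) n noShortcut c m ⟩
      minSteps a (m + c * n)      ≡⟨ cong (minSteps a) ([x+v]%n≡y⇒v≡y∸x+[x+v]/n*n n i≤j ij) ⟨
      minSteps a (s * a + t)      ≤⟨ minSteps-minimal a s t ⟩
      s + t                       ∎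
      where
      open ≤-Reasoning
      c = (toℕ i + (s * a + t)) / n

proposition9 : (n a q r : ℕ) → .{{_ : NonZero n}} → .{{_ : NonZero a}} →
    ((n ≡ q * a) × (4 ≤ a) × (3 ≤ q))
    ⊎ ((n ≡ q * a + r) × (2 ≤ q) × (1 ≤ r) × (r ≤ a ∸ 1) × (4 ≤ a) × (a ≤ r + q + 1)) →
    (i j : Fin n) → toℕ i < toℕ j →
    IsDistance n a i j ((toℕ j ∸ toℕ i) ∸ ((toℕ j ∸ toℕ i) / a) * (a ∸ 1))
proposition9 _ a q _ (inj₁ (refl , _ , _)) i j i<j =
  circulant-distance _ a (minSteps-≤-+-* a q) i j (<⇒≤ i<j)
proposition9 _ a q r (inj₂ (refl , _ , _ , r≤a∸1 , _ , a≤r+q+1)) i j i<j =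
  circulant-distance _ a (minSteps-≤-+-*-+ a q r r≤a a∸1≤r+q) i j (<⇒≤ i<j)
  where
  r≤a : r ≤ a
  r≤a = ≤-trans r≤a∸1 (m∸n≤m a 1)
  a∸1≤r+q : a ∸ 1 ≤ r + q
  a∸1≤r+q = m≤n+o⇒m∸n≤o a 1 (subst (a ≤_) (+-comm _ 1) a≤r+q+1)
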